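{- For all integers $d\ge 2$ and $n\ge 4$, $$\frac{d^n}{2d+1}\le \gamma(cDB(d,1,n))\le (d-1)d^{n-2},$$ and the upper bound equals $\bigl(2-\Theta(1/d)\bigr)\frac{d^n}{2d+1}$.
   Context: Let $[d]=\{1,\dots,d\}$. A sequence $(x_1,\dots,x_n)\in[d]^n$ is $t$-constrained if for all $1\le i<j\le n$ with $x_i=x_j$ one has $j-i\ge t$ (every sequence is $1$-constrained). For $1\le t\le\min\{d,n\}$, $V(d,t,n)$ denotes the set of $t$-constrained sequences in $[d]^n$. The directed $t$-constrained de Bruijn graph $cDB^+(d,t,n)$ is the subgraph of the directed de Bruijn graph on $[d]^n$ (arcs $(a_1,\dots,a_n)\to(a_2,\dots,a_n,a_{n+1})$) induced by $V(d,t,n)$; $cDB(d,t,n)$ is its undirected version, obtained by ignoring arc directions and removing loops and multiple edges. In an undirected graph a vertex dominates itself and its neighbours; a dominating set is a set $S$ of vertices such that every vertex is dominated by some vertex of $S$, and $\gamma(G)$ is the minimum size of a dominating set. -}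

module Defs where

open import Data.Nat using (ℕ; suc; _≤_; _<_; _∸_)
open import Data.Fin using (Fin; toℕ)
open import Data.Vec using (Vec; lookup)
open import Data.List using (List; length)
open import Data.List.Relation.Unary.All using (All)
open import Data.List.Relation.Unary.Any using (Any)
open import Data.List.Relation.Unary.Unique.Propositional using (Unique)
open import Data.Product using (Σ; _×_)
open import Data.Sum using (_⊎_)
open import Relation.Binary.PropositionalEquality using (_≡_; _≢_)

-- Sequences in [d]^n, with [d] represented by Fin d (relabelling 1..d as 0..d-1),
-- positions 1..n represented by Fin n.
Seq : ℕ → ℕ → Set
Seq d n = Vec (Fin d) n

Constrained : {d n : ℕ} → ℕ → Seq d n → Set
Constrained {d} {n} t x =
  (i j : Fin n) → toℕ i < toℕ j → lookup x i ≡ lookup x j → t ≤ toℕ j ∸ toℕ i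

Arc : {d n : ℕ} → Seq d n → Seq d n → Set
Arc {d} {n} x y = (i j : Fin n) → toℕ j ≡ suc (toℕ i) → lookup x j ≡ lookup y i

-- Adjacency in the undirected graph cDB(d,t,n): ignore directions, drop loops.
-- (Both endpoints are required to lie in V(d,t,n) via the dominating-set definition.)
Adj : {d n : ℕ} → Seq d n → Seq d n → Set
Adj x y = x ≢ y × (Arc x y ⊎ Arc y x)

Dominates : {d n : ℕ} → Seq d n → Seq d n → Set
Dominates s v = s ≡ v ⊎ Adj s v

IsDominating : (d t n : ℕ) → List (Seq d n) → Set
IsDominating d t n S =
  All (Constrained t) S ×
  ((v : Seq d n) → Constrained t v → Any (λ s → Dominates s v) S)

-- k = γ(cDB(d,t,n)): k is the minimum size of a dominating set
-- (sets represented as duplicate-free lists).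
IsDominationNumber : (d t n : ℕ) → ℕ → Set
IsDominationNumber d t n k =
  Σ (List (Seq d n)) (λ S → Unique S × IsDominating d t n S × length S ≡ k) ×
  ((S : List (Seq d n)) → Unique S → IsDominating d t n S → k ≤ length S)

-- A vertex s of cDB(d,1,n) dominates at most 2d + 1 vertices: itself, its
-- out-neighbours (s_2, …, s_n, a) and its in-neighbours (a, s_1, …, s_{n-1}).
-- Hence d^n ≤ (2d + 1)γ.  Conversely the (d - 1)d^{n-2} sequences with
-- x_n = x_3 and x_{n-2} ≠ x_1 dominate: a vertex v with v_2 ≠ v_{n-1} has the
-- out-neighbour (v_2, …, v_n, v_4) in this set, and otherwise any in-neighbour
-- (b, v_1, …, v_{n-1}) with b ≠ v_{n-3} is in it.  γ itself exists because
-- the graph is finite, so the existence of a dominating set of each size is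
-- decidable by exhaustive search.
module Submission where

open import Defs
open import Data.Nat using (ℕ; zero; suc; _≤_; _+_; _*_; _∸_; _^_; _<?_; _≤?_; s≤s)
open import Data.Nat.Properties using (≮⇒≥; suc-injective; m<n⇒0<n∸m; ≤-trans; ≤-reflexive)
open import Data.Nat.Tactic.RingSolver using (solve-∀)
open import Data.Fin as Fin using (Fin; zero; suc; toℕ; fromℕ; fromℕ<; inject₁; combine; remQuot; splitAt; _↑ˡ_; _↑ʳ_; punchIn; punchOut)
open import Data.Fin.Properties using (any?; all?; ¬∀⟶∃¬-smallest; toℕ-fromℕ; toℕ-fromℕ<; toℕ-inject; toℕ-inject₁; toℕ-injective; remQuot-combine; combine-remQuot; combine-injective; injective⇒≤; splitAt-↑ˡ; splitAt-↑ʳ; punchIn-injective; punchInᵢ≢i; punchIn-punchOut)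
open import Data.Vec using (Vec; []; _∷_; _∷ʳ_; head; tail; init; last; initLast; lookup)
open import Data.Vec.Properties using (init-∷ʳ; last-∷ʳ; ∷-injective; ∷ʳ-injectiveˡ; tabulate∘lookup; tabulate-cong; ≡-dec)
open import Data.List as List using (List; length)
open import Data.List.Properties using (length-tabulate)
open import Data.List.Relation.Unary.All as All using (All)
open import Data.List.Relation.Unary.Any as Any using (Any)
import Data.List.Relation.Unary.Any.Properties as Any
open import Data.List.Relation.Unary.Unique.Propositional using (Unique)
import Data.List.Relation.Unary.Unique.Propositional.Properties as Unique
import Data.List.Relation.Unary.Unique.DecPropositional as UniqueDec
open import Data.Product using (Σ; ∃; ∃₂; _×_; _,_; proj₁; proj₂)
open import Data.Sum using (_⊎_; inj₁; inj₂; [_,_]′)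
open import Function using (_∘_)
open import Function.Definitions using (Injective)
open import Relation.Nullary using (Dec; yes; no; ¬_; ¬?)
open import Relation.Nullary.Decidable using (map′; decidable-stable; _×-dec_; _⊎-dec_; _→-dec_)
open import Relation.Unary using (Decidable)
open import Relation.Binary.PropositionalEquality using (_≡_; _≢_; refl; sym; trans; cong; cong₂; subst)
open Relation.Binary.PropositionalEquality.≡-Reasoning

private
  variable
    A B : Set
    c d k ℓ m n t : ℕ

Searchable : Set → Set₁
Searchable A = {P : A → Set} → Decidable P → Dec (∃ P)

Vec-searchable : Searchable A → ∀ k → Searchable (Vec A k)
Vec-searchable search zero    P? = map′ ([] ,_) (λ { ([] , p) → p }) (P? [])
Vec-searchable search (suc k) {P} P? =
  map′ (λ (x , xs , p) → x ∷ xs , p) (λ { (x ∷ xs , p) → x , xs , p })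
       (search {λ x → ∃ λ xs → P (x ∷ xs)} λ x → Vec-searchable search k (P? ∘ (x ∷_)))

searchable⇒∀? : Searchable A → {P : A → Set} → Decidable P → Dec (∀ x → P x)
searchable⇒∀? search P? =
  map′ (λ ∄¬ x → decidable-stable (P? x) (λ ¬p → ∄¬ (x , ¬p))) (λ ∀p (x , ¬p) → ¬p (∀p x))
       (¬? (search (¬? ∘ P?)))

∃-ofLength? : Searchable A → ∀ k {P : List A → Set} → Decidable P → Dec (∃ λ xs → P xs × length xs ≡ k)
∃-ofLength? search zero    P? = map′ (λ p → List.[] , p , refl) (λ { (List.[] , p , refl) → p }) (P? List.[])
∃-ofLength? search (suc k) {P} P? =
  map′ (λ (x , xs , p , e) → x List.∷ xs , p , cong suc e)
       (λ { (x List.∷ xs , p , e) → x , xs , p , suc-injective e })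
       (search {λ x → ∃ λ xs → P (x List.∷ xs) × length xs ≡ k} λ x → ∃-ofLength? search k (P? ∘ (x List.∷_)))

least-witness : {Q : ℕ → Set} → Decidable Q → Q m → ∃ λ k → Q k × (∀ {j} → Q j → k ≤ j)
least-witness {m} {Q} Q? q
  with i , ¬¬Qi , below ← ¬∀⟶∃¬-smallest (suc m) (¬_ ∘ Q ∘ toℕ) (¬? ∘ Q? ∘ toℕ)
                            (λ ∀¬Q → ∀¬Q (fromℕ m) (subst Q (sym (toℕ-fromℕ m)) q))
  = toℕ i , decidable-stable (Q? (toℕ i)) ¬¬Qi , λ {j} Qj → ≮⇒≥ λ j<i →
      below (fromℕ< j<i) (subst Q (sym (trans (toℕ-inject (fromℕ< j<i)) (toℕ-fromℕ< j<i))) Qj)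

fromFin : ∀ k → Fin (d ^ k) → Vec (Fin d) k
fromFin zero    _ = []
fromFin {d} (suc k) i = proj₁ (remQuot {d} (d ^ k) i) ∷ fromFin k (proj₂ (remQuot {d} (d ^ k) i))

toFin : Vec (Fin d) k → Fin (d ^ k)
toFin []       = zero
toFin (a ∷ xs) = combine a (toFin xs)

fromFin-toFin : (xs : Vec (Fin d) k) → fromFin k (toFin xs) ≡ xs
fromFin-toFin []                       = refl
fromFin-toFin {d} {suc k} (a ∷ xs) =
  cong₂ _∷_ (cong proj₁ split) (trans (cong (fromFin k ∘ proj₂) split) (fromFin-toFin xs))
  where split = remQuot-combine {d} {d ^ k} a (toFin xs)

toFin-fromFin : ∀ k (i : Fin (d ^ k)) → toFin (fromFin k i) ≡ i
toFin-fromFin zero    zero = refl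
toFin-fromFin {d} (suc k) i =
  trans (cong (combine (proj₁ (remQuot {d} (d ^ k) i))) (toFin-fromFin k _)) (combine-remQuot {d} (d ^ k) i)

fromFin-injective : ∀ k → Injective _≡_ _≡_ (fromFin {d} k)
fromFin-injective k {i} {j} eq = trans (sym (toFin-fromFin k i)) (trans (cong toFin eq) (toFin-fromFin k j))

cover⇒≤ : {ι : Fin m → B} → Injective _≡_ _≡_ ι →
          (f : Fin ℓ → Fin c → B) → (∀ b → ∃₂ λ i t → f i t ≡ b) → m ≤ ℓ * c
cover⇒≤ {m = m} {ℓ = ℓ} {c = c} {ι = ι} ι-injective f cover = injective⇒≤ {f = code} code-injective
  where
  code : Fin m → Fin (ℓ * c)
  code x = combine (proj₁ (cover (ι x))) (proj₁ (proj₂ (cover (ι x))))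

  code-injective : Injective _≡_ _≡_ code
  code-injective {x} {y} eq =
    let i≡i′ , t≡t′ = combine-injective _ _ _ _ eq in
    ι-injective (trans (sym (proj₂ (proj₂ (cover (ι x)))))
                (trans (cong₂ f i≡i′ t≡t′) (proj₂ (proj₂ (cover (ι y))))))

≗-lookup⇒≡ : {xs ys : Vec A n} → (∀ i → lookup xs i ≡ lookup ys i) → xs ≡ ys
≗-lookup⇒≡ {xs = xs} {ys} eq = trans (sym (tabulate∘lookup xs)) (trans (tabulate-cong eq) (tabulate∘lookup ys))

lookup-init : (xs : Vec A (suc n)) (i : Fin n) → lookup (init xs) i ≡ lookup xs (inject₁ i)
lookup-init (x ∷ y ∷ xs) zero    = refl
lookup-init (x ∷ y ∷ xs) (suc i) = lookup-init (y ∷ xs) i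

init-∷ʳ-last : (xs : Vec A (suc n)) → init xs ∷ʳ last xs ≡ xs
init-∷ʳ-last xs = sym (proj₂ (proj₂ (initLast xs)))

Arc⇒tail≡init : (x y : Seq d (suc n)) → Arc x y → tail x ≡ init y
Arc⇒tail≡init (x ∷ xs) y arc = ≗-lookup⇒≡ λ i →
  trans (arc (inject₁ i) (suc i) (cong suc (sym (toℕ-inject₁ i)))) (sym (lookup-init y i))

tail≡init⇒Arc : (x y : Seq d (suc n)) → tail x ≡ init y → Arc x y
tail≡init⇒Arc x y eq i zero ()
tail≡init⇒Arc (x ∷ xs) y eq i (suc j) j≡1+i
  with refl ← toℕ-injective {i = i} {inject₁ j} (trans (suc-injective (sym j≡1+i)) (sym (toℕ-inject₁ j)))
  = trans (cong (λ zs → lookup zs j) eq) (lookup-init y j)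

constrained? : ∀ t (x : Seq d n) → Dec (Constrained t x)
constrained? t x = all? λ i → all? λ j →
  (toℕ i <? toℕ j) →-dec ((lookup x i Fin.≟ lookup x j) →-dec (t ≤? toℕ j ∸ toℕ i))

constrained₁ : (x : Seq d n) → Constrained 1 x
constrained₁ x i j i<j _ = m<n⇒0<n∸m i<j

arc? : (x y : Seq d n) → Dec (Arc x y)
arc? x y = all? λ i → all? λ j → (toℕ j Data.Nat.≟ suc (toℕ i)) →-dec (lookup x j Fin.≟ lookup y i)

dominates? : (s v : Seq d n) → Dec (Dominates s v)
dominates? s v = ≡-dec Fin._≟_ s v ⊎-dec (¬? (≡-dec Fin._≟_ s v) ×-dec (arc? s v ⊎-dec arc? v s))

isDominating? : ∀ d t n → Decidable (IsDominating d t n)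
isDominating? d t n S =
  All.all? (constrained? t) S ×-dec
  searchable⇒∀? (Vec-searchable any? n) (λ v → constrained? t v →-dec Any.any? (λ s → dominates? s v) S)

HasDominatingSetOfSize : (d t n k : ℕ) → Set
HasDominatingSetOfSize d t n k = Σ (List (Seq d n)) (λ S → Unique S × IsDominating d t n S × length S ≡ k)

hasDominatingSetOfSize? : ∀ d t n → Decidable (HasDominatingSetOfSize d t n)
hasDominatingSetOfSize? d t n k =
  map′ (λ (S , (u , dom) , e) → S , u , dom , e) (λ (S , u , dom , e) → S , (u , dom) , e)
       (∃-ofLength? (Vec-searchable any? n) k λ S → UniqueDec.unique? (≡-dec Fin._≟_) S ×-dec isDominating? d t n S)

dominationNumber-exists : {S : List (Seq d n)} → Unique S → IsDominating d t n S → ∃ (IsDominationNumber d t n)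
dominationNumber-exists {d} {n} {t} u dom
  with γ , witness , least ← least-witness (hasDominatingSetOfSize? d t n) (_ , u , dom , refl)
  = γ , witness , λ S′ u′ dom′ → least (S′ , u′ , dom′ , refl)

closedNeighbour : Seq d (suc n) → Fin (suc (d + d)) → Seq d (suc n)
closedNeighbour     s zero    = s
closedNeighbour {d} s (suc t) = [ tail s ∷ʳ_ , _∷ init s ]′ (splitAt d t)

dominates⇒closedNeighbour : {s v : Seq d (suc n)} → Dominates s v → ∃ λ t → closedNeighbour s t ≡ v
dominates⇒closedNeighbour (inj₁ s≡v) = zero , s≡v
dominates⇒closedNeighbour {d} {s = s} {v} (inj₂ (_ , inj₁ arc)) = suc (last v ↑ˡ d) , (begin
  [ tail s ∷ʳ_ , _∷ init s ]′ (splitAt d (last v ↑ˡ d)) ≡⟨ cong [ tail s ∷ʳ_ , _∷ init s ]′ (splitAt-↑ˡ d (last v) d) ⟩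
  tail s ∷ʳ last v                                      ≡⟨ cong (_∷ʳ last v) (Arc⇒tail≡init s v arc) ⟩
  init v ∷ʳ last v                                      ≡⟨ init-∷ʳ-last v ⟩
  v                                                     ∎)
dominates⇒closedNeighbour {d} {s = s} {v ∷ vs} (inj₂ (_ , inj₂ arc)) = suc (d ↑ʳ v) , (begin
  [ tail s ∷ʳ_ , _∷ init s ]′ (splitAt d (d ↑ʳ v)) ≡⟨ cong [ tail s ∷ʳ_ , _∷ init s ]′ (splitAt-↑ʳ d d v) ⟩
  v ∷ init s                                       ≡⟨ cong (v ∷_) (Arc⇒tail≡init (v ∷ vs) s arc) ⟨
  v ∷ vs                                           ∎)

dominating⇒≤ : (S : List (Seq d (suc n))) → IsDominating d 1 (suc n) S → d ^ suc n ≤ length S * suc (d + d)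
dominating⇒≤ {d} {n} S (_ , dominated) =
  cover⇒≤ (fromFin-injective (suc n)) (closedNeighbour ∘ List.lookup S) cover
  where
  cover : ∀ v → ∃₂ λ i t → closedNeighbour (List.lookup S i) t ≡ v
  cover v = let dominator = dominated v (constrained₁ v) in
            Any.index dominator , dominates⇒closedNeighbour (Any.lookup-index dominator)

InUpperSet : Seq d (4 + m) → Set
InUpperSet x = last x ≡ head (tail (tail x)) × last (init (init x)) ≢ head x

-- mid = (x_2, …, x_{n-1}); x_1 ≠ x_{n-2} is coded by punchIn.
build : Fin d → Vec (Fin (suc d)) (2 + m) → Seq (suc d) (4 + m)
build a mid = punchIn (last (init mid)) a ∷ (mid ∷ʳ head (tail mid))

build-injective : ∀ {a a′} {mid mid′ : Vec (Fin (suc d)) (2 + m)} →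
                  build a mid ≡ build a′ mid′ → a ≡ a′ × mid ≡ mid′
build-injective {a = a} {a′} {mid} {mid′} eq
  with head-eq , tail-eq ← ∷-injective eq
  with refl ← ∷ʳ-injectiveˡ mid mid′ tail-eq
  = punchIn-injective (last (init mid)) a a′ head-eq , refl

build-surjective : (x : Seq (suc d) (4 + m)) (x∈ : InUpperSet x) →
                   build (punchOut (proj₂ x∈)) (init (tail x)) ≡ x
build-surjective (x₁ ∷ x₂ ∷ x₃ ∷ x₄ ∷ r) (xₙ≡x₃ , _) = cong₂ _∷_
  (punchIn-punchOut _)
  (trans (cong (init (x₂ ∷ x₃ ∷ x₄ ∷ r) ∷ʳ_) (sym xₙ≡x₃)) (init-∷ʳ-last (x₂ ∷ x₃ ∷ x₄ ∷ r)))

decode : Fin (d * suc d ^ (2 + m)) → Seq (suc d) (4 + m)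
decode {d} {m} i = let a , j = remQuot {d} (suc d ^ (2 + m)) i in build a (fromFin (2 + m) j)

decode-injective : Injective _≡_ _≡_ (decode {d} {m})
decode-injective {d} {m} {i} {j} eq =
  let a≡a′ , mid≡mid′ = build-injective eq in begin
    i                                            ≡⟨ combine-remQuot {d} (suc d ^ (2 + m)) i ⟨
    combine (proj₁ (remQuot {d} _ i)) (proj₂ (remQuot {d} _ i))
      ≡⟨ cong₂ combine a≡a′ (fromFin-injective (2 + m) mid≡mid′) ⟩
    combine (proj₁ (remQuot {d} _ j)) (proj₂ (remQuot {d} _ j))
      ≡⟨ combine-remQuot {d} (suc d ^ (2 + m)) j ⟩
    j                                            ∎

decode-combine : (a : Fin d) (mid : Vec (Fin (suc d)) (2 + m)) → decode (combine a (toFin mid)) ≡ build a mid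
decode-combine {d} {m} a mid =
  cong₂ build (cong proj₁ split) (trans (cong (fromFin (2 + m) ∘ proj₂) split) (fromFin-toFin mid))
  where split = remQuot-combine {d} {suc d ^ (2 + m)} a (toFin mid)

upperSet : ∀ d m → List (Seq (suc d) (4 + m))
upperSet d m = List.tabulate (decode {d} {m})

upperSet-dominates : {s v : Seq (suc d) (4 + m)} → InUpperSet s → Dominates s v →
                     Any (λ s → Dominates s v) (upperSet d m)
upperSet-dominates {s = s} s∈ dom =
  Any.tabulate⁺ (combine (punchOut (proj₂ s∈)) (toFin (init (tail s))))
    (subst (λ s → Dominates s _) (sym (trans (decode-combine _ _) (build-surjective s s∈))) dom)

linked⇒dominates : {s v : Seq d n} → Arc s v ⊎ Arc v s → Dominates s v
linked⇒dominates {s = s} {v} arc with ≡-dec Fin._≟_ s v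
... | yes s≡v = inj₁ s≡v
... | no  s≢v = inj₂ (s≢v , arc)

upperDominator : (v : Seq (suc (suc d)) (4 + m)) → ∃ λ s → InUpperSet s × Dominates s v
upperDominator v@(v₁ ∷ v₂ ∷ v₃ ∷ v₄ ∷ r) with v₂ Fin.≟ last (init v)
... | no v₂≢vₙ₋₁ = s , (last-∷ʳ v₄ (tail v) , sₙ₋₂≢s₁) , linked⇒dominates (inj₂ (tail≡init⇒Arc v s (sym init-s)))
  where
  s = tail v ∷ʳ v₄
  init-s : init s ≡ tail v
  init-s = init-∷ʳ v₄ (tail v)
  sₙ₋₂≢s₁ : last (init (init s)) ≢ v₂
  sₙ₋₂≢s₁ eq = v₂≢vₙ₋₁ (sym (trans (cong (last ∘ init) (sym init-s)) eq))
... | yes v₂≡vₙ₋₁ = s , (sym v₂≡vₙ₋₁ , punchInᵢ≢i _ zero ∘ sym) , linked⇒dominates (inj₁ (tail≡init⇒Arc s v refl))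
  where s = punchIn (last (init (init (init v)))) zero ∷ init v

upperSet-dominating : IsDominating (suc (suc d)) 1 (4 + m) (upperSet (suc d) m)
upperSet-dominating = All.universal constrained₁ _ , λ v _ →
  let s , s∈ , dom = upperDominator v in upperSet-dominates s∈ dom

upperSet-unique : Unique (upperSet d m)
upperSet-unique = Unique.tabulate⁺ decode-injective

dominationNumber-lower : ∀ {γ} → IsDominationNumber d 1 (suc n) γ → d ^ suc n ≤ (2 * d + 1) * γ
dominationNumber-lower {d} {n} ((S , _ , dom , refl) , _) =
  subst (d ^ suc n ≤_) (commute (length S) d) (dominating⇒≤ S dom)
  where
  commute : ∀ ℓ d → ℓ * suc (d + d) ≡ (2 * d + 1) * ℓ
  commute = solve-∀

dominationNumber-upper : ∀ {γ} → IsDominationNumber (suc (suc d)) 1 (4 + m) γ → γ ≤ suc d * suc (suc d) ^ (2 + m)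
dominationNumber-upper {d} {m} (_ , minimal) =
  ≤-trans (minimal _ upperSet-unique upperSet-dominating) (≤-reflexive (length-tabulate (decode {suc d} {m})))

-- (d - 1)d^{n-2} = (2 - (d + 1)/d²) · d^n/(2d + 1), cleared of denominators.
upperBound-ratio : ∀ e p → let d = suc e in
  e * p * (2 * d + 1) * (d * d) + (d + 1) * (d * (d * p)) ≡ 2 * (d * d) * (d * (d * p))
upperBound-ratio = solve-∀

theorem4 : (d n : ℕ) → 2 ≤ d → 4 ≤ n →
    Σ ℕ (λ γ → IsDominationNumber d 1 n γ ×
      d ^ n ≤ (2 * d + 1) * γ ×
      γ ≤ (d ∸ 1) * d ^ (n ∸ 2) ×
      (d ∸ 1) * d ^ (n ∸ 2) * (2 * d + 1) * (d * d) + (d + 1) * d ^ n ≡ 2 * (d * d) * d ^ n)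
theorem4 (suc (suc d)) (suc (suc (suc (suc m)))) (s≤s (s≤s _)) (s≤s (s≤s (s≤s (s≤s _)))) =
  let γ , γ-isDominationNumber = dominationNumber-exists upperSet-unique upperSet-dominating in
  γ , γ-isDominationNumber ,
  dominationNumber-lower γ-isDominationNumber ,
  dominationNumber-upper γ-isDominationNumber ,
  upperBound-ratio (suc d) (suc (suc d) ^ (2 + m))
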